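{- Let $r\geq 3$ and $G=C_3^r$. Suppose there is a sequence $S$ over $G$ of length $|S|=\eta(G)-1$ that contains no short zero-sum subsequence and satisfies $\sigma(S)\neq 0$. Then \begin{enumerate} \item $|\{\eta(G)-2,\eta(G)-3\}\cap C_0(G)|\leq 1$; \item $|\{\eta(G)-3,\eta(G)-4\}\cap C_0(G)|\leq 1$. \end{enumerate}
   Context: $C_3^r$ is the direct sum of $r$ copies of the cyclic group of order $3$. A sequence over $G$ is a finite unordered list of elements of $G$ with repetition allowed; length counts multiplicity, $\sigma(S)$ is the sum of terms. A short zero-sum sequence is a sequence with sum $0$ and length in $[1,\exp(G)]$. $D(G)$ is the smallest $d$ such that every sequence over $G$ of length $\ge d$ has a nonempty zero-sum subsequence; $\eta(G)$ is the smallest $d$ such that every sequence of length $\ge d$ has a short zero-sum subsequence. $C_0(G)$ is the set of integers $t\in[D(G)+1,\eta(G)-1]$ such that every zero-sum sequence over $G$ of length exactly $t$ contains a short zero-sum subsequence. -}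

module Defs where

open import Data.Nat using (ℕ; zero; suc; _≤_; _∸_; _+_)
open import Data.Fin using (Fin; zero; suc)
open import Data.Vec using (Vec; zipWith; replicate)
open import Data.List using (List; []; _∷_; foldr; length)
open import Data.List.Relation.Binary.Sublist.Propositional using (_⊆_)
open import Data.Product using (_×_; Σ-syntax)
open import Relation.Binary.PropositionalEquality using (_≡_)

-- addition in the cyclic group C_3 = Z/3Z, represented by Fin 3
_+₃_ : Fin 3 → Fin 3 → Fin 3
zero +₃ y = y
suc zero +₃ zero = suc zero
suc zero +₃ suc zero = suc (suc zero)
suc zero +₃ suc (suc zero) = zero
suc (suc zero) +₃ zero = suc (suc zero)
suc (suc zero) +₃ suc zero = zero
suc (suc zero) +₃ suc (suc zero) = suc zero

G : ℕ → Set
G r = Vec (Fin 3) r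

0G : ∀ {r} → G r
0G {r} = replicate r zero

_⊕_ : ∀ {r} → G r → G r → G r
_⊕_ = zipWith _+₃_

-- sequences over G (order irrelevant; subsequences = sublists)
Seq : ℕ → Set
Seq r = List (G r)

σ : ∀ {r} → Seq r → G r
σ = foldr _⊕_ 0G

HasZS : ∀ {r} → Seq r → Set
HasZS {r} S = Σ[ T ∈ Seq r ] (T ⊆ S × 1 ≤ length T × σ T ≡ 0G)

-- S has a short zero-sum subsequence (length in [1, exp(G)] = [1,3])
HasShortZS : ∀ {r} → Seq r → Set
HasShortZS {r} S = Σ[ T ∈ Seq r ] (T ⊆ S × 1 ≤ length T × length T ≤ 3 × σ T ≡ 0G)

DProp : ℕ → ℕ → Set
DProp r d = (S : Seq r) → d ≤ length S → HasZS S

IsD : ℕ → ℕ → Set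
IsD r d = DProp r d × ((d' : ℕ) → DProp r d' → d ≤ d')

EtaProp : ℕ → ℕ → Set
EtaProp r d = (S : Seq r) → d ≤ length S → HasShortZS S

IsEta : ℕ → ℕ → Set
IsEta r e = EtaProp r e × ((d' : ℕ) → EtaProp r d' → e ≤ d')

InC0 : (r d e t : ℕ) → Set
InC0 r d e t = (d + 1 ≤ t) × (t ≤ e ∸ 1) ×
  ((S : Seq r) → length S ≡ t → σ S ≡ 0G → HasShortZS S)

{-# OPTIONS --safe #-}
-- Let x = σ S ≠ 0. As |S| = η − 1 and S has no short zero-sum, adjoining −g to S shows that
-- every g ∈ G is the sum of at most two terms of S. If a subsequence T has σ T = x, its
-- complement is a zero-sum sequence of length |S| − |T| without short zero-sum, so that length
-- is not in C₀. Taking g = x settles part 1, and for part 2 leaves only the case x ∈ S. Then, for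
-- a term c ≠ x, writing x − c as a short sum forces x + c ∈ S; repeating this with x + c in place
-- of c gives 2x + c ∈ S, and c, x + c, 2x + c is a short zero-sum.
module Submission where

open import Defs
open import Algebra.Bundles using (AbelianGroup)
open import Algebra.Structures using (IsAbelianGroup)
import Algebra.Properties.AbelianGroup as AbelianGroupProperties
import Algebra.Properties.CommutativeSemigroup as CommutativeSemigroupProperties
open import Data.Empty using (⊥; ⊥-elim)
open import Data.Fin using (zero; suc)
open import Data.Fin.Properties using (all?) renaming (_≟_ to _≟ᶠ_)
open import Data.List using (List; []; _∷_; _++_; length)
open import Data.List.Properties using (length-++)
open import Data.List.Relation.Binary.Permutation.Propositional as ↭
  using (_↭_; refl; prep; swap; ↭-sym; ↭-trans)
open import Data.List.Relation.Binary.Permutation.Propositional.Properties using (↭-length; shift)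
open import Data.List.Relation.Binary.Sublist.Propositional
  using (_⊆_; []; _∷_; _∷ʳ_; ⊆-refl; ⊆-trans; minimum)
open import Data.List.Relation.Binary.Sublist.Propositional.Properties using (++⁺ˡ)
open import Data.Nat using (ℕ; suc; _≤_; _∸_; z≤n; s≤s)
open import Data.Nat.Properties using (≤-refl; ≤-trans; m≤n⇒m≤1+n; m+n∸m≡n; ∸-+-assoc; m≤n+m∸n)
open import Data.Product using (_×_; _,_; ∃-syntax)
open import Data.Vec using ([]; _∷_)
open import Data.Vec.Properties using (zipWith-comm; zipWith-assoc; zipWith-identityˡ; zipWith-identityʳ; ≡-dec)
open import Function using (_∘_)
open import Relation.Nullary using (¬_; yes; no)
open import Relation.Nullary.Decidable using (from-yes)
open import Relation.Binary.PropositionalEquality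
  using (_≡_; _≢_; refl; sym; trans; cong; cong₂; subst; isEquivalence; module ≡-Reasoning)

+₃-identityʳ : ∀ a → a +₃ zero ≡ a
+₃-identityʳ zero = refl
+₃-identityʳ (suc zero) = refl
+₃-identityʳ (suc (suc zero)) = refl

+₃-comm : ∀ a b → a +₃ b ≡ b +₃ a
+₃-comm = from-yes (all? λ a → all? λ b → a +₃ b ≟ᶠ b +₃ a)

+₃-assoc : ∀ a b c → (a +₃ b) +₃ c ≡ a +₃ (b +₃ c)
+₃-assoc = from-yes (all? λ a → all? λ b → all? λ c → (a +₃ b) +₃ c ≟ᶠ a +₃ (b +₃ c))

+₃-triple : ∀ a → a +₃ (a +₃ a) ≡ zero
+₃-triple zero = refl
+₃-triple (suc zero) = refl
+₃-triple (suc (suc zero)) = refl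

⊕-triple : ∀ {r} (a : G r) → a ⊕ (a ⊕ a) ≡ 0G
⊕-triple [] = refl
⊕-triple (a ∷ as) = cong₂ _∷_ (+₃-triple a) (⊕-triple as)

-- G has exponent 3, so the inverse of a is a ⊕ a.
infix 30 ⊖_
⊖_ : ∀ {r} → G r → G r
⊖ a = a ⊕ a

⊕-isAbelianGroup : ∀ r → IsAbelianGroup {A = G r} _≡_ _⊕_ 0G ⊖_
⊕-isAbelianGroup r = record
  { isGroup = record
    { isMonoid = record
      { isSemigroup = record
        { isMagma = record { isEquivalence = isEquivalence ; ∙-cong = cong₂ _⊕_ }
        ; assoc = zipWith-assoc +₃-assoc
        }
      ; identity = zipWith-identityˡ (λ _ → refl) , zipWith-identityʳ +₃-identityʳ
      }
    ; inverse = (λ a → trans (zipWith-assoc +₃-assoc a a a) (⊕-triple a)) , ⊕-triple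
    ; ⁻¹-cong = cong ⊖_
    }
  ; comm = zipWith-comm +₃-comm
  }

⊕-abelianGroup : ℕ → AbelianGroup _ _
⊕-abelianGroup r = record { isAbelianGroup = ⊕-isAbelianGroup r }

module _ {a} {A : Set a} where

  ⊆-↭ : ∀ {xs ys ts : List A} → xs ↭ ys → ts ⊆ xs → ∃[ us ] (us ⊆ ys × us ↭ ts)
  ⊆-↭ refl τ = _ , τ , refl
  ⊆-↭ (prep x p) (.x ∷ʳ τ) with us , υ , q ← ⊆-↭ p τ = us , x ∷ʳ υ , q
  ⊆-↭ (prep x p) (refl ∷ τ) with us , υ , q ← ⊆-↭ p τ = x ∷ us , refl ∷ υ , prep x q
  ⊆-↭ (swap x y p) (.x ∷ʳ .y ∷ʳ τ) with us , υ , q ← ⊆-↭ p τ = us , y ∷ʳ x ∷ʳ υ , q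
  ⊆-↭ (swap x y p) (.x ∷ʳ refl ∷ τ) with us , υ , q ← ⊆-↭ p τ = y ∷ us , refl ∷ x ∷ʳ υ , prep y q
  ⊆-↭ (swap x y p) (refl ∷ .y ∷ʳ τ) with us , υ , q ← ⊆-↭ p τ = x ∷ us , y ∷ʳ refl ∷ υ , prep x q
  ⊆-↭ (swap x y p) (refl ∷ refl ∷ τ) with us , υ , q ← ⊆-↭ p τ =
    y ∷ x ∷ us , refl ∷ refl ∷ υ , swap y x q
  ⊆-↭ (↭.trans p q) τ with us , υ , q₁ ← ⊆-↭ p τ with vs , ν , q₂ ← ⊆-↭ q υ =
    vs , ν , ↭-trans q₂ q₁

  ⊆⇒↭-++ : ∀ {ts xs : List A} → ts ⊆ xs → ∃[ us ] (xs ↭ ts ++ us)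
  ⊆⇒↭-++ [] = [] , refl
  ⊆⇒↭-++ {ts} (y ∷ʳ τ) with us , p ← ⊆⇒↭-++ τ = y ∷ us , ↭-trans (prep y p) (↭-sym (shift y ts us))
  ⊆⇒↭-++ (refl ∷ τ) with us , p ← ⊆⇒↭-++ τ = us , prep _ p

ForcesShortZS : ℕ → ℕ → Set
ForcesShortZS r t = (S : Seq r) → length S ≡ t → σ S ≡ 0G → HasShortZS S

EtaProp-mono : ∀ {r e e′} → e ≤ e′ → EtaProp r e → EtaProp r e′
EtaProp-mono e≤e′ η S e′≤∣S∣ = η S (≤-trans e≤e′ e′≤∣S∣)

module _ {r : ℕ} where
  open AbelianGroup (⊕-abelianGroup r) using (assoc; identityˡ; identityʳ; inverseʳ)
  open AbelianGroupProperties (⊕-abelianGroup r)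
    using (∙-cancelˡ; ∙-cancelʳ; identityʳ-unique; inverseʳ-unique; ⁻¹-involutive; ⁻¹-injective; ε⁻¹≈ε; xyx⁻¹≈y)
  open CommutativeSemigroupProperties (AbelianGroup.commutativeSemigroup (⊕-abelianGroup r))
    using (x∙yz≈y∙xz)

  double≡0⇒≡0 : ∀ {a : G r} → a ⊕ a ≡ 0G → a ≡ 0G
  double≡0⇒≡0 aa≡0 = ⁻¹-injective (trans aa≡0 (sym ε⁻¹≈ε))

  ⊕-absorbs-double⇒≡0 : ∀ {a b : G r} → a ⊕ (a ⊕ b) ≡ b → a ≡ 0G
  ⊕-absorbs-double⇒≡0 {a} {b} eq =
    double≡0⇒≡0 (∙-cancelʳ b (a ⊕ a) 0G (trans (assoc a a b) (trans eq (sym (identityˡ b)))))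

  σ-triple : (a : G r) → σ (a ∷ a ∷ a ∷ []) ≡ 0G
  σ-triple a = trans (cong (λ z → a ⊕ (a ⊕ z)) (identityʳ a)) (⊕-triple a)

  -- The terms c, c + x, c + 2x of an arithmetic progression sum to 3c + 3x = 0.
  σ-arithmetic-progression : (c x : G r) → σ (x ⊕ c ∷ c ∷ x ⊕ (x ⊕ c) ∷ []) ≡ 0G
  σ-arithmetic-progression c x = begin
    v ⊕ (c ⊕ ((x ⊕ v) ⊕ 0G)) ≡⟨ cong (λ z → v ⊕ (c ⊕ z)) (identityʳ (x ⊕ v)) ⟩
    v ⊕ (c ⊕ (x ⊕ v))        ≡⟨ cong (v ⊕_) (x∙yz≈y∙xz c x v) ⟩
    v ⊕ (x ⊕ (c ⊕ v))        ≡⟨ cong (v ⊕_) (sym (assoc x c v)) ⟩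
    v ⊕ (v ⊕ v)              ≡⟨ ⊕-triple v ⟩
    0G                       ∎
    where
    open ≡-Reasoning
    v = x ⊕ c

  σ-++ : (xs ys : Seq r) → σ (xs ++ ys) ≡ σ xs ⊕ σ ys
  σ-++ [] ys = sym (identityˡ (σ ys))
  σ-++ (x ∷ xs) ys = trans (cong (x ⊕_) (σ-++ xs ys)) (sym (assoc x (σ xs) (σ ys)))

  σ-↭ : {xs ys : Seq r} → xs ↭ ys → σ xs ≡ σ ys
  σ-↭ refl = refl
  σ-↭ (prep x p) = cong (x ⊕_) (σ-↭ p)
  σ-↭ (swap x y p) = trans (cong (λ s → x ⊕ (y ⊕ s)) (σ-↭ p)) (x∙yz≈y∙xz x y _)
  σ-↭ (↭.trans p q) = trans (σ-↭ p) (σ-↭ q)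

  HasShortZS-⊆ : {T S : Seq r} → T ⊆ S → HasShortZS T → HasShortZS S
  HasShortZS-⊆ τ (U , υ , short) = U , ⊆-trans υ τ , short

  HasShortZS-↭ : {S S′ : Seq r} → S ↭ S′ → HasShortZS S → HasShortZS S′
  HasShortZS-↭ p (T , τ , 1≤∣T∣ , ∣T∣≤3 , σT≡0) with T′ , τ′ , q ← ⊆-↭ p τ =
    T′ , τ′ , subst (1 ≤_) (sym (↭-length q)) 1≤∣T∣ , subst (_≤ 3) (sym (↭-length q)) ∣T∣≤3 ,
    trans (σ-↭ q) σT≡0

  ¬ForcesShortZS-0 : ¬ ForcesShortZS r 0
  ¬ForcesShortZS-0 forces with forces [] refl refl
  ... | [] , [] , () , _

  short-sum : {S : Seq r} → EtaProp r (suc (length S)) → ¬ HasShortZS S →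
              (g : G r) → ∃[ T ] (T ⊆ S × length T ≤ 2 × σ T ≡ g)
  short-sum {S} η free g with η (⊖ g ∷ S) ≤-refl
  ... | T , _ ∷ʳ τ , short = ⊥-elim (free (T , τ , short))
  ... | _ ∷ T , refl ∷ τ , _ , s≤s ∣T∣≤2 , σ≡0 =
    T , τ , ∣T∣≤2 , trans (inverseʳ-unique (⊖ g) (σ T) σ≡0) (⁻¹-involutive g)

  module Maximal {S : Seq r} (η : EtaProp r (suc (length S))) (free : ¬ HasShortZS S) where

    x : G r
    x = σ S

    free-↭ : {L : Seq r} → L ↭ S → ¬ HasShortZS L
    free-↭ p = free ∘ HasShortZS-↭ p

    short-sum-↭ : {L : Seq r} → L ↭ S → (g : G r) → ∃[ T ] (T ⊆ L × length T ≤ 2 × σ T ≡ g)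
    short-sum-↭ p = short-sum (subst (λ n → EtaProp r (suc n)) (sym (↭-length p)) η) (free-↭ p)

    complement : {L T : Seq r} → L ↭ S → T ⊆ L → σ T ≡ x →
                 ¬ ForcesShortZS r (length S ∸ length T)
    complement {T = T} p τ σT≡x forces with U , q ← ⊆⇒↭-++ τ =
      free-↭ T++U↭S (HasShortZS-⊆ (++⁺ˡ T ⊆-refl) (forces U ∣U∣ σU≡0))
      where
      T++U↭S : T ++ U ↭ S
      T++U↭S = ↭-trans (↭-sym q) p

      ∣U∣ : length U ≡ length S ∸ length T
      ∣U∣ = trans (sym (m+n∸m≡n (length T) (length U)))
                  (cong (_∸ length T) (trans (sym (length-++ T)) (↭-length T++U↭S)))

      σU≡0 : σ U ≡ 0G
      σU≡0 = identityʳ-unique x (σ U)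
        (trans (cong (_⊕ σ U) (sym σT≡x)) (trans (sym (σ-++ T U)) (σ-↭ T++U↭S)))

    not-forced-∸1-∸2 : x ≢ 0G → ForcesShortZS r (length S ∸ 1) → ForcesShortZS r (length S ∸ 2) → ⊥
    not-forced-∸1-∸2 x≢0 F₁ F₂ with short-sum-↭ refl x
    ... | [] , _ , _ , σ≡x = x≢0 (sym σ≡x)
    ... | _ ∷ [] , τ , _ , σ≡x = complement refl τ σ≡x F₁
    ... | _ ∷ _ ∷ [] , τ , _ , σ≡x = complement refl τ σ≡x F₂
    ... | _ ∷ _ ∷ _ ∷ _ , _ , s≤s (s≤s ()) , _

    module _ (x≢0 : x ≢ 0G) (F₂ : ForcesShortZS r (length S ∸ 2)) (F₃ : ForcesShortZS r (length S ∸ 3)) where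

      -- x ⊖ c is a short sum T; every placement of T other than c, x ⊕ c is excluded.
      x⊕c-occurs : {c : G r} {W : Seq r} → x ∷ c ∷ W ↭ S → c ≢ x → (x ⊕ c) ∷ [] ⊆ W
      x⊕c-occurs {c} {W} p c≢x with short-sum-↭ p (x ⊕ ⊖ c)
      ... | T , _ ∷ʳ _ ∷ʳ τ , ∣T∣≤2 , σT = ⊥-elim (avoiding-x-and-c T τ ∣T∣≤2 full)
        where
        full : σ (c ∷ T) ≡ x
        full = trans (cong (c ⊕_) σT) (trans (sym (assoc c x (⊖ c))) (xyx⁻¹≈y c x))

        avoiding-x-and-c : ∀ T → T ⊆ W → length T ≤ 2 → σ (c ∷ T) ≡ x → ⊥
        avoiding-x-and-c [] _ _ c⊕0≡x = c≢x (trans (sym (identityʳ c)) c⊕0≡x)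
        avoiding-x-and-c (_ ∷ []) τ _ eq = complement p (x ∷ʳ refl ∷ τ) eq F₂
        avoiding-x-and-c (_ ∷ _ ∷ []) τ _ eq = complement p (x ∷ʳ refl ∷ τ) eq F₃
        avoiding-x-and-c (_ ∷ _ ∷ _ ∷ _) _ (s≤s (s≤s ())) _
      ... | _ ∷ T , _ ∷ʳ refl ∷ τ , ∣T∣≤2 , σT =
        using-c T τ ∣T∣≤2 (∙-cancelˡ c (σ T) (x ⊕ c) (trans σT (x∙yz≈y∙xz x c c)))
        where
        using-c : ∀ T → T ⊆ W → length (c ∷ T) ≤ 2 → σ T ≡ x ⊕ c → (x ⊕ c) ∷ [] ⊆ W
        using-c [] _ _ 0≡x⊕c = ⊥-elim (free-↭ p
          (x ∷ c ∷ [] , refl ∷ refl ∷ minimum W , s≤s z≤n , s≤s (s≤s z≤n) ,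
           trans (cong (x ⊕_) (identityʳ c)) (sym 0≡x⊕c)))
        using-c (v ∷ []) τ _ v⊕0≡x⊕c = subst (λ w → w ∷ [] ⊆ W) (trans (sym (identityʳ v)) v⊕0≡x⊕c) τ
        using-c (_ ∷ _ ∷ _) _ (s≤s (s≤s ())) _
      ... | _ ∷ T , refl ∷ τ , s≤s ∣T∣≤1 , σT =
        ⊥-elim (using-x T τ ∣T∣≤1 (∙-cancelˡ x (σ T) (⊖ c) σT))
        where
        using-x : ∀ T → T ⊆ c ∷ W → length T ≤ 1 → σ T ≡ ⊖ c → ⊥
        using-x T (_ ∷ʳ τ) ∣T∣≤1 σT≡⊖c = free-↭ p
          (c ∷ T , x ∷ʳ refl ∷ τ , s≤s z≤n , s≤s (m≤n⇒m≤1+n ∣T∣≤1) ,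
           trans (cong (c ⊕_) σT≡⊖c) (inverseʳ c))
        using-x (_ ∷ []) (refl ∷ _) _ c⊕0≡c⊕c = free-↭ p
          (c ∷ [] , x ∷ʳ refl ∷ minimum W , s≤s z≤n , s≤s z≤n ,
           trans (identityʳ c) (sym (∙-cancelˡ c 0G c c⊕0≡c⊕c)))
        using-x (_ ∷ _ ∷ _) (refl ∷ _) (s≤s ()) _

      ¬distinct-second-term : {c : G r} {W : Seq r} → x ∷ c ∷ W ↭ S → c ≢ x → ⊥
      ¬distinct-second-term {c} {W} p c≢x with W₁ , W↭ ← ⊆⇒↭-++ (x⊕c-occurs p c≢x) =
        third-term (x⊕c-occurs p′ v≢x)
        where
        v : G r
        v = x ⊕ c

        p′ : x ∷ v ∷ c ∷ W₁ ↭ S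
        p′ = ↭-trans (prep x (swap v c refl)) (↭-trans (prep x (prep c (↭-sym W↭))) p)

        v≢x : v ≢ x
        v≢x v≡x = free-↭ p
          (c ∷ [] , x ∷ʳ refl ∷ minimum W , s≤s z≤n , s≤s z≤n ,
           trans (identityʳ c) (identityʳ-unique x c v≡x))

        third-term : x ⊕ v ∷ [] ⊆ c ∷ W₁ → ⊥
        third-term (x⊕v≡c ∷ _) = x≢0 (⊕-absorbs-double⇒≡0 x⊕v≡c)
        third-term (_ ∷ʳ τ) = free-↭ p′
          (v ∷ c ∷ x ⊕ v ∷ [] , x ∷ʳ refl ∷ refl ∷ τ , s≤s z≤n , ≤-refl , σ-arithmetic-progression c x)

      ¬leading-x : {U : Seq r} → x ∷ U ↭ S → ⊥
      ¬leading-x {[]} p = ¬ForcesShortZS-0 (subst (λ n → ForcesShortZS r (n ∸ 2)) (sym (↭-length p)) F₂)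
      ¬leading-x {_ ∷ []} p = ¬ForcesShortZS-0 (subst (λ n → ForcesShortZS r (n ∸ 3)) (sym (↭-length p)) F₃)
      ¬leading-x {a ∷ b ∷ U} p with ≡-dec _≟ᶠ_ a x | ≡-dec _≟ᶠ_ b x
      ... | no a≢x | _ = ¬distinct-second-term p a≢x
      ... | yes refl | no b≢x = ¬distinct-second-term (↭-trans (prep x (swap b a refl)) p) b≢x
      ... | yes refl | yes refl = free-↭ p
        (x ∷ x ∷ x ∷ [] , refl ∷ refl ∷ refl ∷ minimum U , s≤s z≤n , ≤-refl , σ-triple x)

      not-forced-∸2-∸3 : ⊥
      not-forced-∸2-∸3 with short-sum-↭ refl x
      ... | [] , _ , _ , σ≡x = x≢0 (sym σ≡x)
      ... | u ∷ [] , τ , _ , u⊕0≡x with U , q ← ⊆⇒↭-++ τ =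
        ¬leading-x (subst (λ u → u ∷ U ↭ S) (trans (sym (identityʳ u)) u⊕0≡x) (↭-sym q))
      ... | _ ∷ _ ∷ [] , τ , _ , σ≡x = complement refl τ σ≡x F₂
      ... | _ ∷ _ ∷ _ ∷ _ , _ , s≤s (s≤s ()) , _

-- Neither 3 ≤ r nor the value of D(G) is needed.
proposition4p10 : (r : ℕ) → 3 ≤ r → (d e : ℕ) → IsD r d → IsEta r e →
    (S : Seq r) → length S ≡ e ∸ 1 → ¬ HasShortZS S → σ S ≢ 0G →
    (¬ (InC0 r d e (e ∸ 2) × InC0 r d e (e ∸ 3))) ×
    (¬ (InC0 r d e (e ∸ 3) × InC0 r d e (e ∸ 4)))
proposition4p10 r _ d e _ (η , _) S ∣S∣≡e∸1 free σ≢0 =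
  (λ (C₂ , C₃) → M.not-forced-∸1-∸2 σ≢0 (forces 1 C₂) (forces 2 C₃)) ,
  (λ (C₃ , C₄) → M.not-forced-∸2-∸3 σ≢0 (forces 2 C₃) (forces 3 C₄))
  where
  module M = Maximal (EtaProp-mono (subst (λ n → e ≤ suc n) (sym ∣S∣≡e∸1) (m≤n+m∸n e 1)) η) free

  forces : ∀ k → InC0 r d e (e ∸ suc k) → ForcesShortZS r (length S ∸ k)
  forces k (_ , _ , F) = subst (ForcesShortZS r) (trans (sym (∸-+-assoc e 1 k)) (cong (_∸ k) (sym ∣S∣≡e∸1))) F
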